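{- Parallel permutation equivalence is an equivalence relation (reflexive, symmetric and transitive) on strongly convergent rewrite sequences.
   Context: Fix a signature $\Sigma$, variables $\mathcal{X}$, the set $T$ of finite and infinite terms, and a term rewriting system $\mathcal{R}$ (rules $\ell\to r$, $\ell$ not a variable, variables of $r$ occurring in $\ell$). A rewrite step at position $p$ is $C[\ell\sigma]\to C[r\sigma]$ with $\ell\to r\in\mathcal{R}$, $\sigma$ a substitution, $C$ a one-hole context with hole at $p$. A strongly convergent rewrite sequence $S: s_0\to^\alpha s_\alpha$ of ordinal length $\alpha$ is a family of steps $(s_\beta\to s_{\beta+1})_{\beta<\alpha}$ such that at each limit $\lambda\le\alpha$ the terms $s_\beta$ converge to $s_\lambda$ in the standard tree metric and the depths of contracted positions tend to infinity as $\beta\to\lambda$. For $\gamma<\alpha$, $\mathrm{rul}(S,\gamma)$ and $\mathrm{pos}(S,\gamma)$ denote the rule and position of step $\gamma$. For positions (words over $\mathbb{N}$), $p\le q$ iff $q=pr$ for some $r$, and $p\parallel q$ iff neither $p\le q$ nor $q\le p$. Strongly convergent rewrite sequences $S$ of length $\alpha$ and $T$ of length $\beta$ from the same starting term are parallel permutation equivalent ($S$ to $T$) if there is a bijection $f:\alpha\to\beta$ with (1) $\mathrm{rul}(S,\gamma)=\mathrm{rul}(T,f(\gamma))$ and $\mathrm{pos}(S,\gamma)=\mathrm{pos}(T,f(\gamma))$ for all $\gamma<\alpha$, and (2) $\mathrm{pos}(S,\gamma_1)\parallel\mathrm{pos}(S,\gamma_2)$ whenever $\gamma_1<\gamma_2<\alpha$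 and $f(\gamma_1)>f(\gamma_2)$. -}

module Defs where

open import Data.Nat using (ℕ; _<_; _≤_; _≟_; _<?_)
open import Data.Fin using (Fin; fromℕ<)
open import Data.List using (List; []; _∷_; _++_; [_]; length)
open import Data.Maybe using (Maybe; just; nothing)
open import Data.Sum using (_⊎_; inj₁; inj₂)
open import Data.Product using (Σ; ∃; ∃-syntax; _×_; _,_)
open import Data.Empty using (⊥)
open import Data.Unit using (⊤)
open import Level using (0ℓ)
open import Relation.Nullary using (¬_; yes; no)
open import Relation.Binary using (Rel; IsStrictTotalOrder)
open import Relation.Binary.PropositionalEquality using (_≡_; _≢_)
open import Induction.WellFounded using (WellFounded)
open import Function.Definitions using (Bijective)

record Signature : Set₁ where
  field
    Sym   : Set
    arity : Sym → ℕ
    Var   : Set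

Pos : Set
Pos = List ℕ

_≤ₚ_ : Pos → Pos → Set
p ≤ₚ q = ∃[ r ] (q ≡ p ++ r)

_∥_ : Pos → Pos → Set
p ∥ q = (¬ p ≤ₚ q) × (¬ q ≤ₚ p)

module _ (Sg : Signature) where
  open Signature Sg

  -- Finite and infinite terms, as labelled trees: a partial map from
  -- positions to labels (function symbols or variables).

  RawTerm : Set
  RawTerm = Pos → Maybe (Sym ⊎ Var)

  record IsTerm (t : RawTerm) : Set where
    field
      root     : t [] ≢ nothing
      parent   : ∀ p i → t (p ++ [ i ]) ≢ nothing →
                 ∃[ f ] (t p ≡ just (inj₁ f) × i < arity f)
      children : ∀ p f i → t p ≡ just (inj₁ f) → i < arity f →
                 t (p ++ [ i ]) ≢ nothing

  _≈ₜ_ : RawTerm → RawTerm → Set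
  s ≈ₜ t = ∀ q → s q ≡ t q

  -- s and t agree at all positions of depth < d
  -- (i.e. tree-metric distance < 2^-(d-1))
  AgreeUpTo : ℕ → RawTerm → RawTerm → Set
  AgreeUpTo d s t = ∀ q → length q < d → s q ≡ t q

  _∣ₚ_ : RawTerm → Pos → RawTerm
  (s ∣ₚ p) q = s (p ++ q)

  sub′ : Maybe (Sym ⊎ Var) → RawTerm → (Var → RawTerm) → RawTerm
  sub′ nothing          _ _ _       = nothing
  sub′ (just (inj₂ x))  _ σ q       = σ x q
  sub′ (just (inj₁ f))  _ _ []      = just (inj₁ f)
  sub′ (just (inj₁ f))  t σ (i ∷ q) = sub′ (t (i ∷ [])) (λ r → t (i ∷ r)) σ q

  _[_]ˢ : RawTerm → (Var → RawTerm) → RawTerm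
  t [ σ ]ˢ = sub′ (t []) t σ

  replace : RawTerm → Pos → RawTerm → RawTerm
  replace s []      u q       = u q
  replace s (i ∷ p) u []      = s []
  replace s (i ∷ p) u (j ∷ q) with i ≟ j
  ... | yes _ = replace (λ r → s (i ∷ r)) p u q
  ... | no  _ = s (j ∷ q)

  data FTerm : Set where
    var : Var → FTerm
    fun : (f : Sym) → (Fin (arity f) → FTerm) → FTerm

  ⟦_⟧ : FTerm → RawTerm
  ⟦ var x ⟧   []      = just (inj₂ x)
  ⟦ var x ⟧   (_ ∷ _) = nothing
  ⟦ fun f ts ⟧ []     = just (inj₁ f)
  ⟦ fun f ts ⟧ (i ∷ q) with i <? arity f
  ... | yes i<n = ⟦ ts (fromℕ< i<n) ⟧ q
  ... | no  _   = nothing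

  IsVar : FTerm → Set
  IsVar (var _)   = ⊤
  IsVar (fun _ _) = ⊥

  Occurs : Var → FTerm → Set
  Occurs x t = ∃[ q ] (⟦ t ⟧ q ≡ just (inj₂ x))

  record TRS : Set₁ where
    field
      Rule        : Set
      lhs rhs     : Rule → FTerm
      lhs-nonvar  : ∀ ρ → ¬ IsVar (lhs ρ)
      rhs-vars    : ∀ ρ x → Occurs x (rhs ρ) → Occurs x (lhs ρ)

  module _ (ℛ : TRS) where
    open TRS ℛ

    Step : RawTerm → RawTerm → Rule → Pos → Set
    Step s t ρ p = Σ (Var → RawTerm) λ σ →
        (∀ x → IsTerm (σ x))
      × ((s ∣ₚ p) ≈ₜ (⟦ lhs ρ ⟧ [ σ ]ˢ))
      × (t ≈ₜ replace s p (⟦ rhs ρ ⟧ [ σ ]ˢ))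

-- Ordinals, as well-ordered types (the ordinal α is the order type of
-- Carrier; its elements are the ordinals γ < α).

record Ordinal : Set₁ where
  field
    Carrier  : Set
    _≺_      : Rel Carrier 0ℓ
    isSTO    : IsStrictTotalOrder _≡_ _≺_
    wf       : WellFounded _≺_

module _ (O : Ordinal) where
  open Ordinal O

  -- α + 1 = { γ ≤ α }, with nothing representing α itself
  data _<⁺_ : Maybe Carrier → Maybe Carrier → Set where
    j<j   : ∀ {a b} → a ≺ b → just a <⁺ just b
    j<top : ∀ {a} → just a <⁺ nothing

  _≤⁺_ : Maybe Carrier → Maybe Carrier → Set
  x ≤⁺ y = (x ≡ y) ⊎ (x <⁺ y)

  IsSucc : Carrier → Maybe Carrier → Set
  IsSucc γ δ = (just γ <⁺ δ) × (∀ ε → just γ <⁺ ε → δ ≤⁺ ε)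

  IsLimit : Maybe Carrier → Set
  IsLimit λ′ = (∃[ b ] (just b <⁺ λ′))
             × (∀ b → just b <⁺ λ′ → ∃[ c ] (b ≺ c × just c <⁺ λ′))

  IsZero : Maybe Carrier → Set
  IsZero x = ∀ y → ¬ (y <⁺ x)

module _ {Sg : Signature} (ℛ : TRS Sg) where
  open Signature Sg
  open TRS ℛ

  record SCSeq : Set₁ where
    field
      ord    : Ordinal
    open Ordinal ord
    field
      term      : Maybe Carrier → RawTerm Sg
      term-ok   : ∀ x → IsTerm Sg (term x)
      start     : RawTerm Sg
      start-ok  : ∀ x → IsZero ord x → _≈ₜ_ Sg (term x) start
      rul       : Carrier → Rule
      pos       : Carrier → Pos
      next      : Carrier → Maybe Carrier
      next-succ : ∀ γ → IsSucc ord γ (next γ)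
      step      : ∀ γ → Step Sg ℛ (term (just γ)) (term (next γ)) (rul γ) (pos γ)
      converge  : ∀ λ′ → IsLimit ord λ′ → ∀ (d : ℕ) →
                  ∃[ b₀ ] (_<⁺_ ord (just b₀) λ′ ×
                    (∀ b → (b₀ ≡ b ⊎ b₀ ≺ b) → _<⁺_ ord (just b) λ′ →
                       AgreeUpTo Sg d (term (just b)) (term λ′)
                       × d ≤ length (pos b)))

  open SCSeq

  PPEquiv : SCSeq → SCSeq → Set
  PPEquiv S T =
    _≈ₜ_ Sg (start S) (start T) ×
    Σ (Ordinal.Carrier (ord S) → Ordinal.Carrier (ord T)) λ f →
        Bijective _≡_ _≡_ f
      × (∀ γ → rul S γ ≡ rul T (f γ) × pos S γ ≡ pos T (f γ))
      × (∀ γ₁ γ₂ → Ordinal._≺_ (ord S) γ₁ γ₂ →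
                   Ordinal._≺_ (ord T) (f γ₂) (f γ₁) →
                   pos S γ₁ ∥ pos S γ₂)

module Submission where

open import Defs
open import Data.Product using (_×_; _,_; proj₁; proj₂)
open import Data.Sum using (_⊎_; inj₁; inj₂)
open import Data.Empty using (⊥-elim)
open import Level using (0ℓ)
open import Function.Base using (id; _∘_)
open import Function.Definitions using (Injective)
import Function.Construct.Identity as Identity
import Function.Construct.Composition as Composition
import Function.Construct.Symmetry as Symmetry
open import Relation.Binary using (Rel; IsEquivalence; IsStrictTotalOrder; tri<; tri≈; tri>)
open import Relation.Binary.Definitions using (Irreflexive; Trichotomous; Reflexive; Symmetric; Transitive)
open import Relation.Binary.PropositionalEquality using (_≡_; refl; sym; trans; cong; subst₂)

∥-sym : ∀ {p q} → p ∥ q → q ∥ p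
∥-sym (p≰q , q≰p) = q≰p , p≰q

module _ {A B : Set} {_<₁_ : Rel A 0ℓ} {_<₂_ : Rel B 0ℓ} where

  injective⇒comparable : Irreflexive _≡_ _<₁_ → Trichotomous _≡_ _<₂_ →
                         (f : A → B) → Injective _≡_ _≡_ f →
                         ∀ {x y} → x <₁ y → f x <₂ f y ⊎ f y <₂ f x
  injective⇒comparable irrefl compare f f-inj {x} {y} x<y with compare (f x) (f y)
  ... | tri< fx<fy _ _ = inj₁ fx<fy
  ... | tri≈ _ fx≡fy _ = ⊥-elim (irrefl (f-inj fx≡fy) x<y)
  ... | tri> _ _ fy<fx = inj₂ fy<fx

module _ {Sg : Signature} {ℛ : TRS Sg} where
  open SCSeq
  open Ordinal using (Carrier; _≺_; isSTO)

  Index : SCSeq ℛ → Set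
  Index S = Carrier (ord S)

  SameSteps : (S T : SCSeq ℛ) → (Index S → Index T) → Set
  SameSteps S T f = ∀ γ → rul S γ ≡ rul T (f γ) × pos S γ ≡ pos T (f γ)

  ParallelInversions : (S T : SCSeq ℛ) → (Index S → Index T) → Set
  ParallelInversions S T f = ∀ γ₁ γ₂ → _≺_ (ord S) γ₁ γ₂ → _≺_ (ord T) (f γ₂) (f γ₁) →
                             pos S γ₁ ∥ pos S γ₂

  parallelInversions-id : (S : SCSeq ℛ) → ParallelInversions S S id
  parallelInversions-id S γ₁ γ₂ γ₁≺γ₂ γ₂≺γ₁ = ⊥-elim (asym γ₁≺γ₂ γ₂≺γ₁)
    where open IsStrictTotalOrder (isSTO (ord S))

  module _ {S T : SCSeq ℛ} {f : Index S → Index T} {f⁻¹ : Index T → Index S}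
           (f∘f⁻¹ : ∀ γ → f (f⁻¹ γ) ≡ γ) (same : SameSteps S T f) where

    sameSteps-inverse : SameSteps T S f⁻¹
    sameSteps-inverse γ =
      sym (trans (proj₁ (same (f⁻¹ γ))) (cong (rul T) (f∘f⁻¹ γ))) ,
      sym (trans (proj₂ (same (f⁻¹ γ))) (cong (pos T) (f∘f⁻¹ γ)))

    parallelInversions-inverse : ParallelInversions S T f → ParallelInversions T S f⁻¹
    parallelInversions-inverse par γ₁ γ₂ γ₁≺γ₂ γ₂′≺γ₁′ =
      subst₂ _∥_ (pos-inverse γ₁) (pos-inverse γ₂)
        (∥-sym (par (f⁻¹ γ₂) (f⁻¹ γ₁) γ₂′≺γ₁′ f-inverts))
      where
      pos-inverse : ∀ γ → pos S (f⁻¹ γ) ≡ pos T γ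
      pos-inverse γ = sym (proj₂ (sameSteps-inverse γ))
      f-inverts : _≺_ (ord T) (f (f⁻¹ γ₁)) (f (f⁻¹ γ₂))
      f-inverts = subst₂ (_≺_ (ord T)) (sym (f∘f⁻¹ γ₁)) (sym (f∘f⁻¹ γ₂)) γ₁≺γ₂

  module _ {S T U : SCSeq ℛ} {f : Index S → Index T} {g : Index T → Index U}
           (sameᶠ : SameSteps S T f) where

    sameSteps-∘ : SameSteps T U g → SameSteps S U (g ∘ f)
    sameSteps-∘ sameᵍ γ =
      trans (proj₁ (sameᶠ γ)) (proj₁ (sameᵍ (f γ))) ,
      trans (proj₂ (sameᶠ γ)) (proj₂ (sameᵍ (f γ)))

    -- An inversion of g ∘ f that f does not invert is an inversion of g.
    parallelInversions-∘ : Injective _≡_ _≡_ f →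
                           ParallelInversions S T f → ParallelInversions T U g →
                           ParallelInversions S U (g ∘ f)
    parallelInversions-∘ f-inj parᶠ parᵍ γ₁ γ₂ γ₁≺γ₂ gf-inverts
      with injective⇒comparable (IsStrictTotalOrder.irrefl (isSTO (ord S)))
             (IsStrictTotalOrder.compare (isSTO (ord T))) f f-inj γ₁≺γ₂
    ... | inj₂ f-inverts = parᶠ γ₁ γ₂ γ₁≺γ₂ f-inverts
    ... | inj₁ fγ₁≺fγ₂ =
      subst₂ _∥_ (sym (proj₂ (sameᶠ γ₁))) (sym (proj₂ (sameᶠ γ₂)))
        (parᵍ (f γ₁) (f γ₂) fγ₁≺fγ₂ gf-inverts)

module _ {Sg : Signature} (ℛ : TRS Sg) where

  PPEquiv-refl : Reflexive (PPEquiv ℛ)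
  PPEquiv-refl {S} =
    (λ _ → refl) , id , Identity.bijective _≡_ , (λ _ → refl , refl) , parallelInversions-id S

  PPEquiv-sym : Symmetric (PPEquiv ℛ)
  PPEquiv-sym {S} {T} (s≈t , f , f-bij@(_ , f-surj) , same , par) =
    (λ q → sym (s≈t q)) , f⁻¹ ,
    Symmetry.bijective f-bij refl sym trans (cong f) ,
    sameSteps-inverse {S = S} {T = T} f∘f⁻¹ same ,
    parallelInversions-inverse {S = S} {T = T} f∘f⁻¹ same par
    where
    f⁻¹ : Index T → Index S
    f⁻¹ = proj₁ ∘ f-surj
    f∘f⁻¹ : ∀ γ → f (f⁻¹ γ) ≡ γ
    f∘f⁻¹ γ = proj₂ (f-surj γ) refl

  PPEquiv-trans : Transitive (PPEquiv ℛ)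
  PPEquiv-trans {S} {T} {U} (s≈t , f , f-bij@(f-inj , _) , sameᶠ , parᶠ)
                            (t≈u , g , g-bij , sameᵍ , parᵍ) =
    (λ q → trans (s≈t q) (t≈u q)) , g ∘ f ,
    Composition.bijective _≡_ _≡_ _≡_ f-bij g-bij ,
    sameSteps-∘ {S = S} {T = T} {U = U} {g = g} sameᶠ sameᵍ ,
    parallelInversions-∘ {S = S} {T = T} {U = U} {g = g} sameᶠ f-inj parᶠ parᵍ

proposition8p14 : (Sg : Signature) (ℛ : TRS Sg) → IsEquivalence (PPEquiv ℛ)
proposition8p14 Sg ℛ = record
  { refl  = λ {S} → PPEquiv-refl ℛ {S}
  ; sym   = λ {S T} → PPEquiv-sym ℛ {S} {T}
  ; trans = λ {S T U} → PPEquiv-trans ℛ {S} {T} {U}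
  }
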